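{- Let $S$ be an S-tree. Then $\alpha(S)=|\operatorname{Supp}(S)|$, and $\operatorname{Supp}(S)$ is the unique maximum independent set of $S$.
   Context: $\alpha$ is the independence number. For a tree $S$, $\mathcal{N}(S)$ is the null space of its adjacency matrix and $\operatorname{Supp}(S)=\{v\in V(S): x_v\neq0\text{ for some }x\in\mathcal{N}(S)\}$. $S$ is an S-tree if $N[\operatorname{Supp}(S)]=V(S)$, where $N[X]=\bigcup_{u\in X}(N(u)\cup\{u\})$. -}

module Defs where

open import Data.Nat using (ℕ; zero; suc; _≤_)
open import Data.Fin using (Fin; zero; suc; inject₁; fromℕ)
open import Data.Fin.Subset using (Subset; _∈_; ∣_∣)
open import Data.Bool using (Bool; true; false; if_then_else_)
open import Data.Rational using (ℚ; 0ℚ; 1ℚ; _+_; _*_)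
open import Data.Product using (Σ; ∃; _×_)
open import Data.Sum using (_⊎_)
open import Function.Definitions using (Injective)
open import Relation.Binary.PropositionalEquality using (_≡_; _≢_)
open import Relation.Nullary using (¬_)

record Graph (n : ℕ) : Set where
  field
    adj    : Fin n → Fin n → Bool
    sym    : ∀ i j → adj i j ≡ adj j i
    irrefl : ∀ i → adj i i ≡ false
open Graph public

Adj : ∀ {n} → Graph n → Fin n → Fin n → Set
Adj G i j = adj G i j ≡ true

Walk : ∀ {n} → Graph n → Fin n → Fin n → Set
Walk {n} G u v = Σ ℕ λ k → Σ (Fin (suc k) → Fin n) λ w →
  (w zero ≡ u) × (w (fromℕ k) ≡ v) × (∀ (i : Fin k) → Adj G (w (inject₁ i)) (w (suc i)))

Connected : ∀ {n} → Graph n → Set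
Connected G = ∀ u v → Walk G u v

-- A cycle of length k+3 >= 3 on distinct vertices.
HasCycle : ∀ {n} → Graph n → Set
HasCycle {n} G = Σ ℕ λ k → Σ (Fin (suc (suc (suc k))) → Fin n) λ c →
  Injective _≡_ _≡_ c ×
  (∀ (i : Fin (suc (suc k))) → Adj G (c (inject₁ i)) (c (suc i))) ×
  Adj G (c (fromℕ (suc (suc k)))) (c zero)

IsTree : ∀ {n} → Graph n → Set
IsTree {n} G = (1 ≤ n) × Connected G × ¬ HasCycle G

sumFin : ∀ {n} → (Fin n → ℚ) → ℚ
sumFin {zero}  f = 0ℚ
sumFin {suc n} f = f zero + sumFin (λ i → f (suc i))

adjMat : ∀ {n} → Graph n → Fin n → Fin n → ℚ
adjMat G i j = if adj G i j then 1ℚ else 0ℚ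

InNullSpace : ∀ {n} → Graph n → (Fin n → ℚ) → Set
InNullSpace G x = ∀ i → sumFin (λ j → adjMat G i j * x j) ≡ 0ℚ

InSupp : ∀ {n} → Graph n → Fin n → Set
InSupp {n} G v = Σ (Fin n → ℚ) λ x → InNullSpace G x × (x v ≢ 0ℚ)

IsSTree : ∀ {n} → Graph n → Set
IsSTree {n} G = IsTree G × (∀ v → InSupp G v ⊎ ∃ λ u → InSupp G u × Adj G u v)

Independent : ∀ {n} → Graph n → Subset n → Set
Independent G I = ∀ i j → i ∈ I → j ∈ I → ¬ Adj G i j

IsIndependenceNumber : ∀ {n} → Graph n → ℕ → Set
IsIndependenceNumber {n} G k =
  (Σ (Subset n) λ I → Independent G I × ∣ I ∣ ≡ k) ×
  (∀ J → Independent G J → ∣ J ∣ ≤ k)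

IsMaximumIndependent : ∀ {n} → Graph n → Subset n → Set
IsMaximumIndependent {n} G I = Independent G I × (∀ J → Independent G J → ∣ J ∣ ≤ ∣ I ∣)

module Submission where

-- Both halves of the argument rest on one fact about forests: no nonempty
-- vertex set W can have every vertex adjacent to two distinct vertices of W
-- (forest⇒noCore).  Otherwise one could walk inside W forever without ever
-- stepping straight back, and cutting such a walk at its first repeated
-- vertex produces a cycle.
--
-- (1) Supp is independent.  A null vector x satisfies Σ_{b ~ a} x_b = 0, so a
--     vertex never has exactly one neighbour where x is nonzero.  An edge uv
--     with x_u ≠ 0 and z_v ≠ 0 for null vectors x, z would therefore spread
--     into a set of minimum degree two.
-- (2) Hall-type inequality: if every vertex of a nonempty A has two
--     neighbours in B, then |A| < |B| (induction, removing a vertex of B with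
--     a single neighbour in A; such a vertex exists by the same forest fact).
-- In an S-tree every vertex outside Supp has a neighbour in Supp, hence two.
-- So for an independent set J, the part J ─ Supp expands into Supp ─ J, and
-- (2) gives |J| < |Supp| unless J ⊆ Supp, i.e. unless J = Supp or J ⊂ Supp.

open import Defs hiding (sym)
open import Data.Nat using (ℕ; zero; suc; _+_; _≤_; _<_; z≤n; s≤s)
open import Data.Nat.Properties
  using ( ≤-refl; ≤-reflexive; ≤-pred; <⇒≤; <⇒≱; <-≤-trans; n<1+n; n≮0; +-suc; +-identityʳ
        ; +-monoʳ-<; m≤n⇒m<n∨m≡n; m≤n⇒∃[o]m+o≡n; module ≤-Reasoning)
open import Data.Fin using (Fin; zero; suc; toℕ; fromℕ; fromℕ<; inject₁)
open import Data.Fin.Properties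
  using (any?; all?; pigeonhole; toℕ<n; toℕ-inject₁; toℕ-fromℕ; toℕ-fromℕ<; <-cmp; suc-injective)
  renaming (_≟_ to _≟ᶠ_)
open import Data.Fin.Subset
  using (Subset; _∈_; _∉_; ∣_∣; _∩_; _─_; _-_; ⁅_⁆; _⊆_; _⊂_; Nonempty; inside; outside)
open import Data.Fin.Subset.Properties
  using ( _∈?_; nonempty?; Empty-unique; ∣⊥∣≡0; ⊆-antisym; ∩-comm; p─⊥≡p; p─q⊆p; p⊂q⇒∣p∣<∣q∣
        ; x∈p∧x∉q⇒x∈p─q; x∈p∧x≢y⇒x∈p-y; x∉⁅y⁆⇒x≢y)
open import Data.Bool using (true; false)
open import Data.Bool.Properties using (T-≡) renaming (_≟_ to _≟ᵇ_)
open import Data.Rational as ℚ using (ℚ; 0ℚ)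
open import Data.Rational.Properties as ℚP using () renaming (_≟_ to _≟ᵠ_)
open import Data.Vec using (_∷_; []; here; there; tabulate)
open import Data.Vec.Properties using (lookup∘tabulate; []=⇒lookup; lookup⇒[]=)
open import Data.Product using (Σ; ∃; ∃₂; _×_; _,_; proj₁; proj₂)
open import Data.Sum using (_⊎_; inj₁; inj₂; [_,_]′; map₂)
open import Data.Empty using (⊥-elim)
open import Function.Base using (_∘_)
open import Function.Bundles using (_⇔_; mk⇔; Equivalence)
open import Relation.Nullary using (¬_; Dec; yes; no)
open import Relation.Nullary.Decidable
  using (isYes; toWitness; fromWitness; ¬?; _×-dec_; decidable-stable)
open import Relation.Unary using (Pred; Decidable)
open import Relation.Binary using (tri<; tri≈; tri>)
open import Relation.Binary.PropositionalEquality

-- Finite subsets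

∣p∣≡∣p∩q∣+∣p─q∣ : ∀ {n} (p q : Subset n) → ∣ p ∣ ≡ ∣ p ∩ q ∣ + ∣ p ─ q ∣
∣p∣≡∣p∩q∣+∣p─q∣ []            []            = refl
∣p∣≡∣p∩q∣+∣p─q∣ (inside  ∷ p) (inside  ∷ q) = cong suc (∣p∣≡∣p∩q∣+∣p─q∣ p q)
∣p∣≡∣p∩q∣+∣p─q∣ (inside  ∷ p) (outside ∷ q) =
  trans (cong suc (∣p∣≡∣p∩q∣+∣p─q∣ p q)) (sym (+-suc _ _))
∣p∣≡∣p∩q∣+∣p─q∣ (outside ∷ p) (inside  ∷ q) = ∣p∣≡∣p∩q∣+∣p─q∣ p q
∣p∣≡∣p∩q∣+∣p─q∣ (outside ∷ p) (outside ∷ q) = ∣p∣≡∣p∩q∣+∣p─q∣ p q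

∣p∣≡1+∣p-x∣ : ∀ {n} {p : Subset n} {x} → x ∈ p → ∣ p ∣ ≡ suc ∣ p - x ∣
∣p∣≡1+∣p-x∣ {p = inside  ∷ p} here      = cong (suc ∘ ∣_∣) (sym (p─⊥≡p p))
∣p∣≡1+∣p-x∣ {p = inside  ∷ p} (there x∈p) = cong suc (∣p∣≡1+∣p-x∣ x∈p)
∣p∣≡1+∣p-x∣ {p = outside ∷ p} (there x∈p) = ∣p∣≡1+∣p-x∣ x∈p

∈⇒0<∣∣ : ∀ {n} {p : Subset n} {x} → x ∈ p → 0 < ∣ p ∣
∈⇒0<∣∣ x∈p = subst (0 <_) (sym (∣p∣≡1+∣p-x∣ x∈p)) (s≤s z≤n)

x∈p─q⇒x∉q : ∀ {n} {p q : Subset n} {x} → x ∈ p ─ q → x ∉ q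
x∈p─q⇒x∉q {p = _ ∷ p} {inside  ∷ q} () here
x∈p─q⇒x∉q {p = _ ∷ p} {_       ∷ q} (there x∈p─q) (there x∈q) = x∈p─q⇒x∉q x∈p─q x∈q

─-empty⇒⊆ : ∀ {n} {p q : Subset n} → ¬ Nonempty (p ─ q) → p ⊆ q
─-empty⇒⊆ {q = q} p─q≡∅ {x} x∈p with x ∈? q
... | yes x∈q = x∈q
... | no  x∉q = ⊥-elim (p─q≡∅ (x , x∈p∧x∉q⇒x∈p─q x∈p x∉q))

⊆⇒≡⊎⊂ : ∀ {n} {p q : Subset n} → p ⊆ q → p ≡ q ⊎ p ⊂ q
⊆⇒≡⊎⊂ {p = p} {q} p⊆q with nonempty? (q ─ p)
... | yes (x , x∈q─p) = inj₂ (p⊆q , x , p─q⊆p q p x∈q─p , x∈p─q⇒x∉q x∈q─p)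
... | no  q─p≡∅       = inj₁ (⊆-antisym p⊆q (─-empty⇒⊆ q─p≡∅))

select : ∀ {n ℓ} {P : Pred (Fin n) ℓ} → Decidable P → Subset n
select P? = tabulate (λ x → isYes (P? x))

∈-select : ∀ {n ℓ} {P : Pred (Fin n) ℓ} (P? : Decidable P) x → x ∈ select P? ⇔ P x
∈-select P? x = mk⇔
  (λ x∈ → toWitness {a? = P? x} (Equivalence.from T-≡ (trans (sym (lookup∘tabulate _ x)) ([]=⇒lookup x∈))))
  (λ px → lookup⇒[]= x _ (trans (lookup∘tabulate _ x) (Equivalence.to T-≡ (fromWitness px))))

-- Sequences in a finite set

DistinctBelow : ∀ {n} → (ℕ → Fin n) → ℕ → Set
DistinctBelow f m = ∀ {x y} → x < y → y < m → f x ≢ f y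

FirstRepeat : ∀ {n} → (ℕ → Fin n) → Set
FirstRepeat f = ∃₂ λ i j → i < j × f i ≡ f j × DistinctBelow f j

distinctOrRepeat : ∀ {n} (f : ℕ → Fin n) m → DistinctBelow f m ⊎ FirstRepeat f
distinctOrRepeat f zero = inj₁ (λ _ ())
distinctOrRepeat f (suc m) with distinctOrRepeat f m
... | inj₂ repeat = inj₂ repeat
... | inj₁ distinct with any? (λ (x : Fin m) → f (toℕ x) ≟ᶠ f m)
...   | yes (x , fx≡fm) = inj₂ (toℕ x , m , toℕ<n x , fx≡fm , distinct)
...   | no  fresh = inj₁ extended
  where
  extended : DistinctBelow f (suc m)
  extended x<y (s≤s y≤m) with m≤n⇒m<n∨m≡n y≤m
  ... | inj₁ y<m  = distinct x<y y<m
  ... | inj₂ refl = λ fx≡fm → fresh (fromℕ< x<y , trans (cong f (toℕ-fromℕ< x<y)) fx≡fm)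

-- By the pigeonhole principle a sequence in Fin n cannot be injective on
-- its first n+1 positions, so it has a first repetition.
firstRepeat : ∀ {n} (f : ℕ → Fin n) → FirstRepeat f
firstRepeat {n} f with distinctOrRepeat f (suc n)
... | inj₂ repeat = repeat
... | inj₁ distinct with pigeonhole (n<1+n n) (λ (i : Fin (suc n)) → f (toℕ i))
...   | i , j , i<j , fi≡fj = ⊥-elim (distinct i<j (toℕ<n j) fi≡fj)

-- Walks in forests

adj-sym : ∀ {n} (G : Graph n) {a b} → Adj G a b → Adj G b a
adj-sym G {a} {b} ab = trans (Graph.sym G b a) ab

adj-irrefl : ∀ {n} (G : Graph n) {a b} → Adj G a b → a ≢ b
adj-irrefl G {a} ab refl with trans (sym ab) (Graph.irrefl G a)
... | ()

record NonBacktrackingWalk {n} (G : Graph n) : Set where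
  field
    vertex   : ℕ → Fin n
    step     : ∀ k → Adj G (vertex k) (vertex (suc k))
    noReturn : ∀ k → vertex (suc (suc k)) ≢ vertex k

module _ {n} {G : Graph n} where
  open NonBacktrackingWalk

  shift : NonBacktrackingWalk G → ℕ → NonBacktrackingWalk G
  vertex   (shift ω i) k = vertex ω (i + k)
  step     (shift ω i) k = subst (Adj G _) (cong (vertex ω) (sym (+-suc i k))) (step ω (i + k))
  noReturn (shift ω i) k = noReturn ω (i + k) ∘ trans (cong (vertex ω) (sym i+[k+2]≡i+k+2))
    where
    i+[k+2]≡i+k+2 : i + suc (suc k) ≡ suc (suc (i + k))
    i+[k+2]≡i+k+2 = trans (+-suc i (suc k)) (cong suc (+-suc i k))

  -- A closed non-backtracking walk of length L+1 whose vertices are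
  -- distinct before it closes is a cycle: L = 0 would be a loop and L = 1
  -- an immediate return, so the cycle has at least three vertices.
  closedWalk⇒cycle : (ω : NonBacktrackingWalk G) (L : ℕ) → vertex ω (suc L) ≡ vertex ω 0 →
                     DistinctBelow (vertex ω) (suc L) → HasCycle G
  closedWalk⇒cycle ω zero          closed _        = ⊥-elim (adj-irrefl G (step ω 0) (sym closed))
  closedWalk⇒cycle ω (suc zero)    closed _        = ⊥-elim (noReturn ω 0 closed)
  closedWalk⇒cycle ω (suc (suc k)) closed distinct = k , cycle , injective , path , closing
    where
    cycle : Fin (suc (suc (suc k))) → Fin n
    cycle m = vertex ω (toℕ m)

    injective : ∀ {x y} → cycle x ≡ cycle y → x ≡ y
    injective {x} {y} cx≡cy with <-cmp x y
    ... | tri< x<y _ _ = ⊥-elim (distinct x<y (toℕ<n y) cx≡cy)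
    ... | tri≈ _ x≡y _ = x≡y
    ... | tri> _ _ y<x = ⊥-elim (distinct y<x (toℕ<n x) (sym cx≡cy))

    path : ∀ m → Adj G (cycle (inject₁ m)) (cycle (suc m))
    path m = subst (λ t → Adj G (vertex ω t) (cycle (suc m))) (sym (toℕ-inject₁ m)) (step ω (toℕ m))

    closing : Adj G (cycle (fromℕ (suc (suc k)))) (cycle zero)
    closing = subst₂ (λ t u → Adj G (vertex ω t) u) (sym (toℕ-fromℕ _)) closed (step ω (suc (suc k)))

  -- A forest admits no infinite non-backtracking walk: cut the walk at its
  -- first repeated vertex to obtain a cycle.
  forest⇒noNonBacktrackingWalk : ¬ HasCycle G → ¬ NonBacktrackingWalk G
  forest⇒noNonBacktrackingWalk acyclic ω with firstRepeat (vertex ω)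
  ... | i , j , i<j , vi≡vj , distinct with m≤n⇒∃[o]m+o≡n i<j
  ...   | L , i+1+L≡j = acyclic (closedWalk⇒cycle (shift ω i) L closed distinctAfter)
    where
    i+[1+L]≡j : i + suc L ≡ j
    i+[1+L]≡j = trans (+-suc i L) i+1+L≡j

    closed : vertex ω (i + suc L) ≡ vertex ω (i + 0)
    closed = trans (cong (vertex ω) i+[1+L]≡j) (trans (sym vi≡vj) (cong (vertex ω) (sym (+-identityʳ i))))

    distinctAfter : DistinctBelow (λ k → vertex ω (i + k)) (suc L)
    distinctAfter x<y y<1+L = distinct (+-monoʳ-< i x<y) (subst (_ <_) i+[1+L]≡j (+-monoʳ-< i y<1+L))

-- Vertex sets of minimum degree two

-- a has at least two distinct neighbours in W: whatever vertex p is
-- excluded, a neighbour of a in W different from p remains.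
TwoNeighboursIn : ∀ {n} → Graph n → (Fin n → Set) → Fin n → Set
TwoNeighboursIn {n} G W a = ∀ p → Σ (Fin n) λ w → W w × Adj G a w × w ≢ p

module _ {n} (G : Graph n) where

  twoNeighbours : ∀ {W : Fin n → Set} {a b b′} → b′ ≢ b → W b → W b′ → Adj G a b → Adj G a b′ →
                  TwoNeighboursIn G W a
  twoNeighbours {b = b} {b′} b′≢b Wb Wb′ ab ab′ p with b ≟ᶠ p
  ... | yes refl = b′ , Wb′ , ab′ , b′≢b
  ... | no  b≢p  = b , Wb , ab , b≢p

  twoNeighbours-mono : ∀ {V W : Fin n → Set} {a} → (∀ v → Adj G a v → V v → W v) →
                       TwoNeighboursIn G V a → TwoNeighboursIn G W a
  twoNeighbours-mono V⇒W two p with two p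
  ... | v , Vv , av , v≢p = v , V⇒W v av Vv , av , v≢p

  -- In a vertex set in which every vertex has two neighbours inside the set,
  -- a walk can always continue without stepping back: from the current vertex
  -- move to a neighbour in the set other than the previous vertex.
  module CoreWalk (W : Fin n → Set) (core : ∀ w → W w → TwoNeighboursIn G W w) where

    -- the current vertex, which lies in W, and the previously visited vertex
    State : Set
    State = Σ (Fin n) W × Fin n

    current : State → Fin n
    current = proj₁ ∘ proj₁

    move : (s : State) → Σ (Fin n) λ w → W w × Adj G (current s) w × w ≢ proj₂ s
    move ((w , Ww) , previous) = core w Ww previous

    advance : State → State
    advance s = (proj₁ (move s) , proj₁ (proj₂ (move s))) , current s

    states : State → ℕ → State
    states s zero    = s
    states s (suc k) = advance (states s k)

    walk : State → NonBacktrackingWalk G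
    walk s = record
      { vertex   = λ k → current (states s k)
      ; step     = λ k → proj₁ (proj₂ (proj₂ (move (states s k))))
      ; noReturn = λ k → proj₂ (proj₂ (proj₂ (move (states s (suc k)))))
      }

  forest⇒noCore : ¬ HasCycle G → (W : Fin n → Set) → (∀ w → W w → TwoNeighboursIn G W w) →
                  ∀ w → ¬ W w
  forest⇒noCore acyclic W core w Ww =
    forest⇒noNonBacktrackingWalk acyclic (CoreWalk.walk W core ((w , Ww) , w))

-- A Hall-type inequality in forests

adj? : ∀ {n} (G : Graph n) a b → Dec (Adj G a b)
adj? G a b = adj G a b ≟ᵇ true

Expanding : ∀ {n} → Graph n → Subset n → Subset n → Set
Expanding G A B = ∀ a → a ∈ A → TwoNeighboursIn G (_∈ B) a

Pendant : ∀ {n} → Graph n → Subset n → Subset n → Fin n → Set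
Pendant G A B b = b ∈ B × (∃ λ a → a ∈ A × Adj G b a) × ¬ TwoNeighboursIn G (_∈ A) b

module _ {n} (G : Graph n) where

  twoNeighboursIn? : ∀ A b → Dec (TwoNeighboursIn G (_∈ A) b)
  twoNeighboursIn? A b = all? λ p → any? λ w → (w ∈? A) ×-dec adj? G b w ×-dec ¬? (w ≟ᶠ p)

  pendant? : ∀ A B b → Dec (Pendant G A B b)
  pendant? A B b = (b ∈? B) ×-dec any? (λ a → (a ∈? A) ×-dec adj? G b a) ×-dec ¬? (twoNeighboursIn? A b)

  -- Deleting a pendant b together with its neighbour a ∈ A preserves expansion:
  -- no other vertex of A is adjacent to b.
  removePendant : ∀ {A B a b} → Expanding G A B → a ∈ A → Adj G b a →
                  ¬ TwoNeighboursIn G (_∈ A) b → Expanding G (A - a) (B - b)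
  removePendant {A} {a = a} {b} expanding a∈A ba ¬two a′ a′∈A-a p
    with expanding a′ (p─q⊆p A ⁅ a ⁆ a′∈A-a) p
  ... | b′ , b′∈B , a′b′ , b′≢p with b′ ≟ᶠ b
  ...   | yes refl = ⊥-elim (¬two (twoNeighbours G a′≢a a∈A (p─q⊆p A ⁅ a ⁆ a′∈A-a) ba (adj-sym G a′b′)))
    where
    a′≢a : a′ ≢ a
    a′≢a = x∉⁅y⁆⇒x≢y (x∈p─q⇒x∉q a′∈A-a)
  ...   | no b′≢b = b′ , x∈p∧x≢y⇒x∈p-y b′∈B b′≢b , a′b′ , b′≢p

module _ {n} (G : Graph n) (acyclic : ¬ HasCycle G) where

  -- Without pendants, A together with its neighbours in B has minimum degree
  -- two, which a forest forbids unless A is empty.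
  noPendant⇒empty : ∀ {A B} → Expanding G A B → (∀ b → ¬ Pendant G A B b) → ∀ a → a ∉ A
  noPendant⇒empty {A} {B} expanding noPendant a a∈A = forest⇒noCore G acyclic W core a (inj₁ a∈A)
    where
    W : Fin n → Set
    W w = w ∈ A ⊎ (w ∈ B × ∃ λ a → a ∈ A × Adj G w a)

    core : ∀ w → W w → TwoNeighboursIn G W w
    core w (inj₁ w∈A) =
      twoNeighbours-mono G (λ b wb b∈B → inj₂ (b∈B , w , w∈A , adj-sym G wb)) (expanding w w∈A)
    core w (inj₂ (w∈B , neighbourInA)) with twoNeighboursIn? G A w
    ... | yes two = twoNeighbours-mono G (λ _ _ → inj₁) two
    ... | no ¬two = ⊥-elim (noPendant w (w∈B , neighbourInA , ¬two))

  -- Proof by induction,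
  -- deleting a pendant of B and its neighbour in A.
  expanding⇒smaller : ∀ {A B} → Expanding G A B → Nonempty A → ∣ A ∣ < ∣ B ∣
  expanding⇒smaller {A} = bySize ∣ A ∣ ≤-refl
    where
    bySize : ∀ k {A B} → ∣ A ∣ ≤ k → Expanding G A B → Nonempty A → ∣ A ∣ < ∣ B ∣
    bySize zero    ∣A∣≤0 _ (a , a∈A) = ⊥-elim (n≮0 (<-≤-trans (∈⇒0<∣∣ a∈A) ∣A∣≤0))
    bySize (suc k) {A} {B} ∣A∣≤1+k expanding (a₀ , a₀∈A) with any? (pendant? G A B)
    ... | no noPendant = ⊥-elim (noPendant⇒empty expanding (λ b p → noPendant (b , p)) a₀ a₀∈A)
    ... | yes (b , b∈B , (a , a∈A , ba) , ¬two) = begin-strict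
      ∣ A ∣           ≡⟨ ∣p∣≡1+∣p-x∣ a∈A ⟩
      suc ∣ A - a ∣   <⟨ s≤s smaller ⟩
      suc ∣ B - b ∣   ≡⟨ ∣p∣≡1+∣p-x∣ b∈B ⟨
      ∣ B ∣           ∎
      where
      open ≤-Reasoning
      smaller : ∣ A - a ∣ < ∣ B - b ∣
      smaller with nonempty? (A - a)
      ... | yes nonempty = bySize k (≤-pred (subst (_≤ suc k) (∣p∣≡1+∣p-x∣ a∈A) ∣A∣≤1+k))
                                  (removePendant G expanding a∈A ba ¬two) nonempty
      ... | no empty with expanding a a∈A b
      ...   | b′ , b′∈B , _ , b′≢b = subst (_< ∣ B - b ∣) (sym (trans (cong ∣_∣ (Empty-unique empty)) (∣⊥∣≡0 n)))
                                         (∈⇒0<∣∣ (x∈p∧x≢y⇒x∈p-y b′∈B b′≢b))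

-- Null vectors of the adjacency matrix

sumFin-zero : ∀ {n} (f : Fin n → ℚ) → (∀ j → f j ≡ 0ℚ) → sumFin f ≡ 0ℚ
sumFin-zero {zero}  f f≡0 = refl
sumFin-zero {suc n} f f≡0 =
  trans (cong₂ ℚ._+_ (f≡0 zero) (sumFin-zero (f ∘ suc) (f≡0 ∘ suc))) (ℚP.+-identityʳ 0ℚ)

sumFin-single : ∀ {n} (f : Fin n → ℚ) b → (∀ j → j ≢ b → f j ≡ 0ℚ) → sumFin f ≡ f b
sumFin-single {suc n} f zero    f≡0 =
  trans (cong (f zero ℚ.+_) (sumFin-zero (f ∘ suc) (λ j → f≡0 (suc j) λ ()))) (ℚP.+-identityʳ (f zero))
sumFin-single {suc n} f (suc b) f≡0 =
  trans (cong (ℚ._+ sumFin (f ∘ suc)) (f≡0 zero λ ()))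
        (trans (ℚP.+-identityˡ _) (sumFin-single (f ∘ suc) b (λ j j≢b → f≡0 (suc j) (j≢b ∘ suc-injective))))

sumFin-secondNonzero : ∀ {n} (f : Fin n → ℚ) b → sumFin f ≡ 0ℚ → f b ≢ 0ℚ →
                       Σ (Fin n) λ j → j ≢ b × f j ≢ 0ℚ
sumFin-secondNonzero f b sum≡0 fb≢0 with any? (λ j → ¬? (j ≟ᶠ b) ×-dec ¬? (f j ≟ᵠ 0ℚ))
... | yes found = found
... | no  none  = ⊥-elim (fb≢0 (trans (sym (sumFin-single f b vanishes)) sum≡0))
  where
  vanishes : ∀ j → j ≢ b → f j ≡ 0ℚ
  vanishes j j≢b = decidable-stable (f j ≟ᵠ 0ℚ) (λ fj≢0 → none (j , j≢b , fj≢0))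

module _ {n} (G : Graph n) {a j : Fin n} (y : Fin n → ℚ) where

  adjMat-neighbour : Adj G a j → adjMat G a j ℚ.* y j ≡ y j
  adjMat-neighbour aj rewrite aj = ℚP.*-identityˡ (y j)

  adjMat-nonzero : adjMat G a j ℚ.* y j ≢ 0ℚ → Adj G a j × y j ≢ 0ℚ
  adjMat-nonzero term≢0 with adj G a j
  ... | true  = refl , term≢0 ∘ trans (ℚP.*-identityˡ (y j))
  ... | false = ⊥-elim (term≢0 (ℚP.*-zeroˡ (y j)))

-- Around every vertex a, a null vector is never nonzero at exactly one
-- neighbour: the entries at the neighbours of a sum to zero.
nullVector-spread : ∀ {n} (G : Graph n) {y : Fin n → ℚ} → InNullSpace G y → ∀ {a b} →
                    Adj G a b → y b ≢ 0ℚ → Σ (Fin n) λ b′ → b′ ≢ b × Adj G a b′ × y b′ ≢ 0ℚ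
nullVector-spread G {y} null {a} {b} ab yb≢0
  with sumFin-secondNonzero (λ j → adjMat G a j ℚ.* y j) b (null a) (yb≢0 ∘ trans (sym (adjMat-neighbour G y ab)))
... | b′ , b′≢b , term≢0 = b′ , b′≢b , adjMat-nonzero G y term≢0

-- The support of the null space of a forest

module ForestSupport {n} (G : Graph n) (acyclic : ¬ HasCycle G) where

  Linked : (Fin n → ℚ) → (Fin n → ℚ) → Fin n → Set
  Linked x z a = x a ≢ 0ℚ × ∃ λ b → Adj G a b × z b ≢ 0ℚ

  linked-twoNeighbours : ∀ {x z} → InNullSpace G z → ∀ {a} → Linked x z a → TwoNeighboursIn G (Linked z x) a
  linked-twoNeighbours null (xa≢0 , b , ab , zb≢0) with nullVector-spread G null ab zb≢0
  ... | b′ , b′≢b , ab′ , zb′≢0 =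
    twoNeighbours G b′≢b (zb≢0 , _ , adj-sym G ab , xa≢0) (zb′≢0 , _ , adj-sym G ab′ , xa≢0) ab ab′

  -- The support of the null space is independent: an edge uv with u, v in the
  -- support would generate a set of minimum degree two.
  supp-independent : ∀ {u v} → InSupp G u → InSupp G v → ¬ Adj G u v
  supp-independent {u} {v} (x , xNull , xu≢0) (z , zNull , zv≢0) uv =
    forest⇒noCore G acyclic W core u (inj₁ (xu≢0 , v , uv , zv≢0))
    where
    W : Fin n → Set
    W a = Linked x z a ⊎ Linked z x a

    core : ∀ w → W w → TwoNeighboursIn G W w
    core w (inj₁ linked) = twoNeighbours-mono G (λ _ _ → inj₂) (linked-twoNeighbours zNull linked)
    core w (inj₂ linked) = twoNeighbours-mono G (λ _ _ → inj₁) (linked-twoNeighbours xNull linked)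

  module STree (closed : ∀ v → InSupp G v ⊎ ∃ λ u → InSupp G u × Adj G u v) where

    -- Membership in the support is decidable: the two alternatives of
    -- closedness exclude each other by independence of the support.
    inSupp? : ∀ v → Dec (InSupp G v)
    inSupp? v with closed v
    ... | inj₁ v∈supp            = yes v∈supp
    ... | inj₂ (u , u∈supp , uv) = no λ v∈supp → supp-independent u∈supp v∈supp uv

    Supp : Subset n
    Supp = select inSupp?

    ∈Supp : ∀ v → v ∈ Supp ⇔ InSupp G v
    ∈Supp = ∈-select inSupp?

    Supp-independent : Independent G Supp
    Supp-independent u v u∈Supp v∈Supp =
      supp-independent (Equivalence.to (∈Supp u) u∈Supp) (Equivalence.to (∈Supp v) v∈Supp)

    nonSupp-twoNeighbours : ∀ a → ¬ InSupp G a → TwoNeighboursIn G (InSupp G) a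
    nonSupp-twoNeighbours a a∉supp with closed a
    ... | inj₁ a∈supp = ⊥-elim (a∉supp a∈supp)
    ... | inj₂ (u , (x , xNull , xu≢0) , ua) with nullVector-spread G xNull (adj-sym G ua) xu≢0
    ...   | u′ , u′≢u , au′ , xu′≢0 =
      twoNeighbours G u′≢u (x , xNull , xu≢0) (x , xNull , xu′≢0) (adj-sym G ua) au′

    -- Every independent set is the support or strictly smaller.  Its part J ─ Supp
    -- outside the support expands into Supp ─ J, so the Hall-type inequality applies.
    supp-dominates : ∀ J → Independent G J → J ≡ Supp ⊎ ∣ J ∣ < ∣ Supp ∣
    supp-dominates J J-independent with nonempty? (J ─ Supp)
    ... | yes nonempty = inj₂ (begin-strict
      ∣ J ∣                          ≡⟨ ∣p∣≡∣p∩q∣+∣p─q∣ J Supp ⟩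
      ∣ J ∩ Supp ∣ + ∣ J ─ Supp ∣    <⟨ +-monoʳ-< ∣ J ∩ Supp ∣ (expanding⇒smaller G acyclic expanding nonempty) ⟩
      ∣ J ∩ Supp ∣ + ∣ Supp ─ J ∣    ≡⟨ cong (λ s → ∣ s ∣ + ∣ Supp ─ J ∣) (∩-comm J Supp) ⟩
      ∣ Supp ∩ J ∣ + ∣ Supp ─ J ∣    ≡⟨ ∣p∣≡∣p∩q∣+∣p─q∣ Supp J ⟨
      ∣ Supp ∣                       ∎)
      where
      open ≤-Reasoning
      expanding : Expanding G (J ─ Supp) (Supp ─ J)
      expanding a a∈J─Supp = twoNeighbours-mono G inSuppOutsideJ
        (nonSupp-twoNeighbours a (x∈p─q⇒x∉q a∈J─Supp ∘ Equivalence.from (∈Supp a)))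
        where
        inSuppOutsideJ : ∀ v → Adj G a v → InSupp G v → v ∈ Supp ─ J
        inSuppOutsideJ v av v∈supp = x∈p∧x∉q⇒x∈p─q (Equivalence.from (∈Supp v) v∈supp)
          (λ v∈J → J-independent a v (p─q⊆p J Supp a∈J─Supp) v∈J av)
    ... | no empty = map₂ p⊂q⇒∣p∣<∣q∣ (⊆⇒≡⊎⊂ (─-empty⇒⊆ empty))

mainTheorem8 : ∀ {n : ℕ} (S : Graph n) → IsSTree S →
    Σ (Subset n) λ I →
    (∀ v → (v ∈ I) ⇔ InSupp S v) ×
    IsIndependenceNumber S ∣ I ∣ ×
    IsMaximumIndependent S I ×
    (∀ J → IsMaximumIndependent S J → J ≡ I)
mainTheorem8 S ((_ , _ , acyclic) , closed) =
  Supp , ∈Supp , ((Supp , Supp-independent , refl) , maximum) , (Supp-independent , maximum) , unique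
  where
  open ForestSupport S acyclic
  open STree closed

  maximum : ∀ J → Independent S J → ∣ J ∣ ≤ ∣ Supp ∣
  maximum J J-independent = [ ≤-reflexive ∘ cong ∣_∣ , <⇒≤ ]′ (supp-dominates J J-independent)

  unique : ∀ J → IsMaximumIndependent S J → J ≡ Supp
  unique J (J-independent , J-maximum) with supp-dominates J J-independent
  ... | inj₁ J≡Supp  = J≡Supp
  ... | inj₂ smaller = ⊥-elim (<⇒≱ smaller (J-maximum Supp Supp-independent))
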